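{- Let $(\delta,K_1,K_2,C_0,C_1)$ be admissible parameters satisfying Case II, and put $C=\min(C_0,C_1)$. Let $\mathbf C$ be a cycle of odd perimeter with distances $d_1,\dots,d_{2n+2},x_1,\dots,x_k$ (some $n\ge0$, $k\ge0$) such that $\sum_{i=1}^{2n+2}d_i>2K_2+n(C-1)+\sum_{i=1}^kx_i$, and suppose that $\mathbf C$ is not a $C$-cycle. Then $d_i>K_2$ for all $i$, $x_j<K_1$ for all $j$, and $\sum_j x_j<2K_1$.
   Context: A $\delta$-edge-labelled cycle is a cycle graph (at least 3 vertices) with edge labels in $\{1,\dots,\delta\}$; it "has distances $d_1,\dots,d_m$" if its edges can be listed in some (arbitrary) order with these labels; its perimeter is the sum of labels. A $C$-cycle is a cycle which, for some $n'\ge0$, has distances $e_0,\dots,e_{2n'},y_1,\dots,y_m$ with $\sum_{i=0}^{2n'}e_i>n'(C-1)+\sum y_i$. Parameters: integers with $3\le\delta<\infty$, $1\le K_1\le K_2\le\delta$, $2\delta+2\le C_0,C_1\le3\delta+2$, $C_0$ even, $C_1$ odd; $C=\min(C_0,C_1)$, $C'=\max(C_0,C_1)$. Case II (admissible) means: $C\le2\delta+K_1$, $C=2K_1+2K_2+1$, $K_1+K_2\ge\delta$, $K_1+2K_2\le2\delta-1$, and either $C'=C+1$, or $C'>C+1$, $K_1=K_2$ and $3K_2=2\delta-1$. -}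

module Defs where

open import Data.Nat using (ℕ; zero; suc; _+_; _*_; _∸_; _≤_; _<_; _⊔_; _⊓_; _%_)
open import Data.List using (List; length; _++_)
open import Data.Nat.ListAction using (sum)
open import Data.List.Relation.Unary.All using (All)
open import Data.List.Relation.Binary.Permutation.Propositional using (_↭_)
open import Data.Product using (Σ; ∃; ∃-syntax; _×_)
open import Data.Sum using (_⊎_)
open import Relation.Binary.PropositionalEquality using (_≡_)

-- A δ-edge-labelled cycle: a cycle graph with m ≥ 3 vertices, given by the
-- labels of its m edges listed in cyclic order; every label lies in {1,…,δ}.
record LabelledCycle (δ : ℕ) : Set where
  constructor mkCycle
  field
    labels    : List ℕ
    enough    : 3 ≤ length labels
    inRange   : All (λ l → 1 ≤ l × l ≤ δ) labels
open LabelledCycle public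

HasDistances : ∀ {δ} → LabelledCycle δ → List ℕ → Set
HasDistances Cy ds = labels Cy ↭ ds

perimeter : ∀ {δ} → LabelledCycle δ → ℕ
perimeter Cy = sum (labels Cy)

Odd : ℕ → Set
Odd n = n % 2 ≡ 1

Even : ℕ → Set
Even n = n % 2 ≡ 0

IsCCycle : ∀ {δ} → ℕ → LabelledCycle δ → Set
IsCCycle C Cy =
  ∃[ n' ] ∃[ es ] ∃[ ys ]
    (length es ≡ 2 * n' + 1 × HasDistances Cy (es ++ ys) ×
     n' * (C ∸ 1) + sum ys < sum es)

record Admissible (δ K₁ K₂ C₀ C₁ : ℕ) : Set where
  field
    δ≥3    : 3 ≤ δ
    K₁≥1   : 1 ≤ K₁
    K₁≤K₂  : K₁ ≤ K₂
    K₂≤δ   : K₂ ≤ δ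
    C₀-lo  : 2 * δ + 2 ≤ C₀
    C₀-hi  : C₀ ≤ 3 * δ + 2
    C₁-lo  : 2 * δ + 2 ≤ C₁
    C₁-hi  : C₁ ≤ 3 * δ + 2
    C₀-even : Even C₀
    C₁-odd  : Odd C₁

record CaseII (δ K₁ K₂ C₀ C₁ : ℕ) : Set where
  field
    admissible : Admissible δ K₁ K₂ C₀ C₁
    c1 : C₀ ⊓ C₁ ≤ 2 * δ + K₁
    c2 : C₀ ⊓ C₁ ≡ 2 * K₁ + 2 * K₂ + 1
    c3 : δ ≤ K₁ + K₂
    c4 : K₁ + 2 * K₂ ≤ 2 * δ ∸ 1
    c5 : (C₀ ⊔ C₁ ≡ suc (C₀ ⊓ C₁))
         ⊎ (suc (C₀ ⊓ C₁) < C₀ ⊔ C₁ × K₁ ≡ K₂ × 3 * K₂ ≡ 2 * δ ∸ 1)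

{-# OPTIONS --safe #-}
module Submission where

open import Defs
open import Data.Nat using (ℕ; _+_; _*_; _∸_; _<_; _⊓_)
open import Data.List using (List; length; _++_)
open import Data.Nat.ListAction using (sum)
open import Data.List.Relation.Unary.All using (All)
open import Data.Product using (_×_)
open import Relation.Binary.PropositionalEquality using (_≡_)
open import Relation.Nullary using (¬_)

open import Data.Nat using (suc; _≤_; z≤n)
open import Data.Nat.Properties
open import Data.Nat.ListAction.Properties using (sum-↭)
open import Data.Nat.Tactic.RingSolver using (solve)
open import Data.List using ([]; _∷_)
import Data.List.Relation.Unary.All as All
open import Data.List.Relation.Unary.All.Properties using (++⁻ˡ)
open import Data.List.Membership.Propositional using (_∈_)
open import Data.List.Membership.Propositional.Properties using (∈-∃++)
open import Data.List.Relation.Binary.Permutation.Propositional using (_↭_; ↭-sym; ↭-trans)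
open import Data.List.Relation.Binary.Permutation.Propositional.Properties
  using (All-resp-↭; shift; ++⁺ˡ; ++⁺ʳ; ↭-length)
open import Data.Product using (_,_; proj₂; ∃-syntax)
open import Function using (_∘′_)
open import Relation.Binary.PropositionalEquality using (refl; sym; trans; cong; subst)

-- Write c = C - 1 = 2K₁ + 2K₂.  If some dᵢ ≤ K₂, moving it from the d's to the
-- x's leaves 2n+1 distances whose sum still exceeds n·c plus the rest, so the
-- cycle would be a C-cycle.  If some xⱼ ≥ K₁, moving it to the d's gives 2n+3
-- distances exceeding (n+1)·c plus the rest, again a C-cycle.  Finally
-- Σ dᵢ ≤ (2n+2)δ ≤ (n+1)(2K₁+2K₂) = 2K₂ + n·c + 2K₁ forces Σ xⱼ < 2K₁.

sum≤length*max : ∀ {m} (l : List ℕ) → All (_≤ m) l → sum l ≤ length l * m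
sum≤length*max []      All.[]         = z≤n
sum≤length*max (x ∷ l) (x≤m All.∷ ps) = +-mono-≤ x≤m (sum≤length*max l ps)

∈⇒↭∷ : ∀ {A : Set} {x : A} {xs : List A} → x ∈ xs → ∃[ ys ] xs ↭ x ∷ ys
∈⇒↭∷ {x = x} x∈xs with ys , zs , refl ← ∈-∃++ x∈xs = ys ++ zs , shift x ys zs

move-to-right : ∀ {A : Set} {x : A} {ys} xs zs → xs ↭ x ∷ ys → xs ++ zs ↭ ys ++ x ∷ zs
move-to-right {x = x} {ys} xs zs p = ↭-trans (++⁺ʳ zs p) (↭-sym (shift x ys zs))

move-to-left : ∀ {A : Set} {x : A} {zs} xs ys → ys ↭ x ∷ zs → xs ++ ys ↭ (x ∷ xs) ++ zs
move-to-left {x = x} {zs} xs ys p = ↭-trans (++⁺ˡ xs p) (shift x xs zs)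

surplus-after-demoting : ∀ K {m X S d} → 2 * K + m + X < d + S → d ≤ K →
                         m + (d + X) < S
surplus-after-demoting K {m} {X} {S} {d} h d≤K = +-cancelˡ-< d _ _ (begin-strict
  d + (m + (d + X)) ≡⟨ solve (d ∷ m ∷ X ∷ []) ⟩
  2 * d + m + X     ≤⟨ +-monoˡ-≤ X (+-monoˡ-≤ m (*-monoʳ-≤ 2 d≤K)) ⟩
  2 * K + m + X     <⟨ h ⟩
  d + S             ∎)
  where open ≤-Reasoning

surplus-after-promoting : ∀ K₁ K₂ n {X D x} →
  2 * K₂ + n * (2 * K₁ + 2 * K₂) + (x + X) < D → K₁ ≤ x →
  suc n * (2 * K₁ + 2 * K₂) + X < x + D
surplus-after-promoting K₁ K₂ n {X} {D} {x} h K₁≤x = begin-strict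
  suc n * (2 * K₁ + 2 * K₂) + X
    ≡⟨ solve (K₁ ∷ K₂ ∷ n ∷ X ∷ []) ⟩
  2 * K₁ + (2 * K₂ + n * (2 * K₁ + 2 * K₂) + X)
    ≤⟨ +-monoˡ-≤ _ (*-monoʳ-≤ 2 K₁≤x) ⟩
  2 * x + (2 * K₂ + n * (2 * K₁ + 2 * K₂) + X)
    ≡⟨ solve (x ∷ K₁ ∷ K₂ ∷ n ∷ X ∷ []) ⟩
  x + (2 * K₂ + n * (2 * K₁ + 2 * K₂) + (x + X))
    <⟨ +-monoʳ-< x h ⟩
  x + D
    ∎
  where open ≤-Reasoning

extras-bounded : ∀ K₁ K₂ n {δ X D} → δ ≤ K₁ + K₂ →
  2 * K₂ + n * (2 * K₁ + 2 * K₂) + X < D → D ≤ (2 * n + 2) * δ → X < 2 * K₁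
extras-bounded K₁ K₂ n {δ} {X} {D} δ≤K h D≤ =
  +-cancelˡ-< (2 * K₂ + n * (2 * K₁ + 2 * K₂)) _ _ (begin-strict
    2 * K₂ + n * (2 * K₁ + 2 * K₂) + X      <⟨ h ⟩
    D                                       ≤⟨ D≤ ⟩
    (2 * n + 2) * δ                         ≤⟨ *-monoʳ-≤ (2 * n + 2) δ≤K ⟩
    (2 * n + 2) * (K₁ + K₂)                 ≡⟨ solve (K₁ ∷ K₂ ∷ n ∷ []) ⟩
    2 * K₂ + n * (2 * K₁ + 2 * K₂) + 2 * K₁ ∎)
  where open ≤-Reasoning

module _ {δ : ℕ} (C : ℕ) (Cy : LabelledCycle δ) (n : ℕ) {ds xs : List ℕ}
         (len : length ds ≡ 2 * n + 2) (dist : HasDistances Cy (ds ++ xs)) where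

  short-distance⇒IsCCycle : ∀ K {d} → 2 * K + n * (C ∸ 1) + sum xs < sum ds →
                            d ∈ ds → d ≤ K → IsCCycle C Cy
  short-distance⇒IsCCycle K {d} h d∈ds d≤K
    with ds′ , ds↭ ← ∈⇒↭∷ d∈ds =
    n , ds′ , d ∷ xs , length-ds′ , ↭-trans dist (move-to-right ds xs ds↭) ,
    surplus-after-demoting K (subst (_ <_) (sum-↭ ds↭) h) d≤K
    where
    length-ds′ : length ds′ ≡ 2 * n + 1
    length-ds′ = suc-injective
      (trans (sym (↭-length ds↭)) (trans len (+-suc (2 * n) 1)))

  long-extra⇒IsCCycle : ∀ K₁ K₂ {x} → C ∸ 1 ≡ 2 * K₁ + 2 * K₂ →
                        2 * K₂ + n * (C ∸ 1) + sum xs < sum ds →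
                        x ∈ xs → K₁ ≤ x → IsCCycle C Cy
  long-extra⇒IsCCycle K₁ K₂ c≡ h x∈xs K₁≤x
    with xs′ , xs↭ ← ∈⇒↭∷ x∈xs rewrite c≡ =
    suc n , _ ∷ ds , xs′ , length-x∷ds , ↭-trans dist (move-to-left ds xs xs↭) ,
    surplus-after-promoting K₁ K₂ n (subst (λ s → _ + s < _) (sum-↭ xs↭) h) K₁≤x
    where
    length-x∷ds : suc (length ds) ≡ 2 * suc n + 1
    length-x∷ds = trans (cong suc len) (solve (n ∷ []))

-- Neither the odd perimeter nor the Case II conditions other than
-- C = 2K₁ + 2K₂ + 1 and δ ≤ K₁ + K₂ are needed.
mainTheorem8 : (δ K₁ K₂ C₀ C₁ : ℕ) → CaseII δ K₁ K₂ C₀ C₁ →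
    (Cy : LabelledCycle δ) → Odd (perimeter Cy) →
    (n : ℕ) (ds xs : List ℕ) → length ds ≡ 2 * n + 2 →
    HasDistances Cy (ds ++ xs) →
    2 * K₂ + n * ((C₀ ⊓ C₁) ∸ 1) + sum xs < sum ds →
    ¬ IsCCycle (C₀ ⊓ C₁) Cy →
    All (λ d → K₂ < d) ds × All (λ x → x < K₁) xs × sum xs < 2 * K₁
mainTheorem8 δ K₁ K₂ C₀ C₁ caseII Cy _ n ds xs len dist h notC =
  All.tabulate (λ d∈ds → ≰⇒> (notC ∘′ short-distance⇒IsCCycle C Cy n len dist K₂ h d∈ds)) ,
  All.tabulate (λ x∈xs → ≰⇒> (notC ∘′ long-extra⇒IsCCycle C Cy n len dist K₁ K₂ c≡ h x∈xs)) ,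
  extras-bounded K₁ K₂ n (CaseII.c3 caseII)
    (subst (λ c → 2 * K₂ + n * c + sum xs < sum ds) c≡ h)
    (subst (λ l → sum ds ≤ l * δ) len (sum≤length*max ds ds≤δ))
  where
  C = C₀ ⊓ C₁
  c≡ : C ∸ 1 ≡ 2 * K₁ + 2 * K₂
  c≡ = cong (_∸ 1) (trans (CaseII.c2 caseII) (+-comm _ 1))
  ds≤δ : All (_≤ δ) ds
  ds≤δ = ++⁻ˡ ds (All.map proj₂ (All-resp-↭ dist (inRange Cy)))
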